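{- Let $n\geq 27$ and let $u\in B^*$ with $\varphi_n(u)$ equal to the identity permutation. If some factor of the circular word $\langle\gamma_n(u)\rangle$ has exponent strictly larger than $n/(n-1)$, then the circular word $\langle u\rangle$ has a factor $v$ satisfying one of the following: (i) $v$ is a $k$-stabilizing word of order $n$ with $0<|v|<k(n-1)$, for some $1\leq k\leq n-1$; or (ii) $v$ is a kernel repetition of order $n$.
   Context: Let $A_n=\{1,\dots,n\}$ and $B=\{0,1\}$. Let $\mathbb{S}_n$ be the symmetric group on $A_n$, with permutations acting on the right (written $a\pi$), so that products are composed left to right. Define the monoid morphism $\varphi_n:B^*\to\mathbb{S}_n$ by $\varphi_n(0)=(1\ 2\ \cdots\ n-1)$ and $\varphi_n(1)=(1\ 2\ \cdots\ n)$ (cycle notation), so $\varphi_n(b_1\cdots b_i)=\varphi_n(b_1)\cdots\varphi_n(b_i)$. Define $\gamma_n:B^*\to A_n^*$ by $\gamma_n(b_1\cdots b_k)=a_1\cdots a_k$ where $a_i$ is the unique letter with $a_i\varphi_n(b_1\cdots b_i)=1$, for $1\le i\le k$. A period $p$ of a word $w=w_1\cdots w_k$ is a positive integer with $w_{i+p}=w_i$ for $1\le i\le k-p$; the exponent of $w$ is the maximum of $|w|/p$ over its periods. For $1\le k\le n-1$, a nonempty word $v\in B^+$ is a $k$-stabilizing word (of order $n$) if $\varphi_n(v)$ fixes each of $1,2,\dots,k$. A word $v\in B^*$ is a kernel repetition of order $n$ if it has a period $p$ and a factor $v'$ of length $p$ with $\varphi_n(v')$ the identity and $|v|>\frac{np}{n-1}-(n-1)$.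 The circular word $\langle w\rangle$ is the set of conjugates of $w$ (words $vu$ where $w=uv$); a factor of $\langle w\rangle$ is a factor of some conjugate of $w$. -}

module Defs where

open import Data.Nat using (ℕ; zero; suc; _+_; _*_; _∸_; _≤_; _<_; _≟_; _<ᵇ_)
open import Data.Bool using (Bool; true; false; if_then_else_)
open import Data.Fin using (Fin; zero; suc)
open import Data.List using (List; []; _∷_; _++_; length; reverse)
open import Data.Maybe using (Maybe; just; nothing)
open import Data.Product using (Σ; ∃; ∃-syntax; _×_; _,_)
open import Relation.Nullary using (yes; no)
open import Relation.Binary.PropositionalEquality using (_≡_)

-- The binary alphabet B = {0,1}: Fin 2, with zero = 0 and suc zero = 1.
B : Set
B = Fin 2

-- Letters of A_n are the natural numbers 1,…,n (values outside are never used
-- as letters; the permutations below fix them).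

-- The cycle (1 2 ⋯ m) acting on a letter a (right action a ↦ a(1 2 ⋯ m)).
cyc : ℕ → ℕ → ℕ
cyc m zero = zero
cyc m (suc a) with suc a <ᵇ m
... | true  = suc (suc a)
... | false with suc a ≟ m
...   | yes _ = 1
...   | no  _ = suc a

φgen : ℕ → B → ℕ → ℕ
φgen n zero    a = cyc (n ∸ 1) a
φgen n (suc _) a = cyc n a

-- a φ_n(w): action of the permutation φ_n(w) on the letter a, products composed
-- left to right: a φ_n(b w) = (a φ_n(b)) φ_n(w).
act : ℕ → List B → ℕ → ℕ
act n []      a = a
act n (b ∷ w) a = act n w (φgen n b a)

FixesUpTo : ℕ → List B → ℕ → Set
FixesUpTo n w k = ∀ a → 1 ≤ a → a ≤ k → act n w a ≡ a

IsIdentity : ℕ → List B → Set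
IsIdentity n w = FixesUpTo n w n

-- first letter a in {i, i+1, …, i+c-1} with a φ_n(w) = 1 (default 1).
search : ℕ → List B → ℕ → ℕ → ℕ
search n w i zero = 1
search n w i (suc c) with act n w i ≟ 1
... | yes _ = i
... | no  _ = search n w (suc i) c

preimageOf1 : ℕ → List B → ℕ
preimageOf1 n w = search n w 1 n

-- γ_n(b_1⋯b_k) = a_1⋯a_k with a_i φ_n(b_1⋯b_i) = 1.
-- Implemented with an accumulator holding the reversed prefix.
γaux : ℕ → List B → List B → List ℕ
γaux n revPre []      = []
γaux n revPre (b ∷ w) = preimageOf1 n (reverse (b ∷ revPre)) ∷ γaux n (b ∷ revPre) w

γ : ℕ → List B → List ℕ
γ n u = γaux n [] u

at : {A : Set} → List A → ℕ → Maybe A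
at []      _       = nothing
at (x ∷ w) zero    = just x
at (x ∷ w) (suc i) = at w i

IsPeriod : {A : Set} → List A → ℕ → Set
IsPeriod w p = 1 ≤ p × (∀ i → i + p < length w → at w (i + p) ≡ at w i)

-- The exponent of w (max of |w|/p over periods p) is strictly larger than
-- num/den, i.e. some period p has |w|/p > num/den, i.e. num·p < |w|·den.
ExponentGreaterThan : {A : Set} → List A → ℕ → ℕ → Set
ExponentGreaterThan w num den = ∃[ p ] (IsPeriod w p × num * p < length w * den)

Factor : {A : Set} → List A → List A → Set
Factor v w = ∃[ x ] ∃[ y ] (w ≡ x ++ v ++ y)

Conjugate : {A : Set} → List A → List A → Set
Conjugate c w = ∃[ s ] ∃[ t ] (w ≡ s ++ t × c ≡ t ++ s)

CircFactor : {A : Set} → List A → List A → Set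
CircFactor v w = ∃[ c ] (Conjugate c w × Factor v c)

KStabilizing : ℕ → ℕ → List B → Set
KStabilizing n k v = 1 ≤ k × k ≤ n ∸ 1 × 1 ≤ length v × FixesUpTo n v k

-- v is a kernel repetition of order n: a period p and a factor v' of v of length p
-- with φ_n(v') = id and |v| > np/(n-1) - (n-1), i.e. (multiplying by n-1 > 0)
-- n·p < |v|·(n-1) + (n-1)².
KernelRepetition : ℕ → List B → Set
KernelRepetition n v =
  ∃[ p ] (IsPeriod v p ×
          (∃[ v' ] (Factor v' v × length v' ≡ p × IsIdentity n v')) ×
          n * p < length v * (n ∸ 1) + (n ∸ 1) * (n ∸ 1))

module Submission where

-- The trace τ_X(i) of X ∈ B* is the letter sent to 1 by
-- φ_n(X[0,i)), so γ_n(X) = τ_X(1) ⋯ τ_X(|X|).  Both generators act as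
-- r ↦ r+1 for r < n-1, hence X[0,i+r) sends τ_X(i) to r+1, and a repetition
-- τ_X(j) = τ_X(j+P) makes the window X[j+r, j+r+P) fix r+1.  As φ_n(u) = id,
-- a circular factor w of γ_n(u) with period p and np < |w|(n-1) is a
-- p-periodic stretch of the trace of uu; write |w| = p + L, so p < L(n-1).
-- If L ≤ n-1, the length-p window at offset L is L-stabilizing: outcome (i).
-- If L ≥ n, every length-p window at offset ≥ n-1 fixes 1, …, n-1, hence is
-- the identity; consecutive identity windows bT and Tc force c = b, so they
-- cover a factor of period p, a kernel repetition: outcome (ii).  Windows of
-- uu inside one conjugate are circular factors of u.

open import Defs
open import Data.Nat using (ℕ; zero; suc; _+_; _*_; _∸_; _≤_; _<_; _≟_; _≤?_; _<?_; _<ᵇ_; _≤ᵇ_; z≤n; s≤s)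
open import Data.Nat.Properties
open import Data.Nat.Solver using (module +-*-Solver)
open import Data.Bool using (true; false; T)
open import Data.Fin using (zero; suc)
open import Data.List using (List; []; _∷_; _++_; length; reverse; take; drop)
open import Data.List.Properties
  using (++-assoc; length-++; length-take; length-drop; take++drop≡id; drop-drop; take-take;
         reverse-++; unfold-reverse; reverse-involutive)
open import Data.Maybe using (just)
open import Data.Maybe.Properties using (just-injective)
open import Data.Product using (Σ; ∃-syntax; _×_; _,_; proj₁; proj₂)
open import Data.Sum using (_⊎_; inj₁; inj₂)
open import Data.Empty using (⊥-elim)
open import Relation.Nullary using (yes; no)
open import Relation.Binary using (tri<; tri≈; tri>)
open import Relation.Binary.PropositionalEquality
open +-*-Solver using (solve; _:=_; _:+_; _:*_; con)

cyc-below : ∀ m a → suc a < m → cyc m (suc a) ≡ suc (suc a)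
cyc-below m a lt with suc a <ᵇ m | <⇒<ᵇ lt
... | true  | _ = refl
... | false | ()

cyc-top : ∀ a → cyc (suc a) (suc a) ≡ 1
cyc-top a with suc a <ᵇ suc a in eq
... | true = ⊥-elim (n≮n (suc a) (<ᵇ⇒< (suc a) (suc a) (subst T (sym eq) _)))
... | false with suc a ≟ suc a
...   | yes _ = refl
...   | no ne = ⊥-elim (ne refl)

cyc-above : ∀ m a → m < suc a → cyc m (suc a) ≡ suc a
cyc-above m a gt with suc a <ᵇ m in eq
... | true = ⊥-elim (<-asym gt (<ᵇ⇒< (suc a) m (subst T (sym eq) _)))
... | false with suc a ≟ m
...   | yes e = ⊥-elim (<⇒≢ gt (sym e))
...   | no _ = refl

-- The inverse cycle (m ⋯ 2 1): 1 ↦ m, a+1 ↦ a for 2 ≤ a+1 ≤ m, letters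
-- above m fixed.  It is needed to show that φ_n(w) permutes A_n.
cyc⁻¹ : ℕ → ℕ → ℕ
cyc⁻¹ m zero = zero
cyc⁻¹ m (suc zero) = m
cyc⁻¹ m (suc (suc a)) with suc (suc a) ≤ᵇ m
... | true = suc a
... | false = suc (suc a)

cyc⁻¹-below : ∀ m a → suc (suc a) ≤ m → cyc⁻¹ m (suc (suc a)) ≡ suc a
cyc⁻¹-below m a le with suc (suc a) ≤ᵇ m | ≤⇒≤ᵇ le
... | true | _ = refl
... | false | ()

cyc⁻¹-above : ∀ m a → m < suc (suc a) → cyc⁻¹ m (suc (suc a)) ≡ suc (suc a)
cyc⁻¹-above m a gt with suc (suc a) ≤ᵇ m in eq
... | true = ⊥-elim (<⇒≱ gt (≤ᵇ⇒≤ (suc (suc a)) m (subst T (sym eq) _)))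
... | false = refl

cyc-cyc⁻¹ : ∀ m x → 1 ≤ m → 1 ≤ x → cyc m (cyc⁻¹ m x) ≡ x
cyc-cyc⁻¹ (suc m) (suc zero) _ _ = cyc-top m
cyc-cyc⁻¹ m (suc (suc a)) _ _ with suc (suc a) ≤? m
... | yes le = trans (cong (cyc m) (cyc⁻¹-below m a le)) (cyc-below m a le)
... | no nle = trans (cong (cyc m) (cyc⁻¹-above m a gt)) (cyc-above m (suc a) gt)
  where gt = ≰⇒> nle

cyc⁻¹-cyc : ∀ m x → 1 ≤ m → 1 ≤ x → cyc⁻¹ m (cyc m x) ≡ x
cyc⁻¹-cyc m (suc a) _ _ with <-cmp (suc a) m
cyc⁻¹-cyc m (suc a) _ _ | tri< lt _ _ = trans (cong (cyc⁻¹ m) (cyc-below m a lt)) (cyc⁻¹-below m a lt)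
cyc⁻¹-cyc .(suc a) (suc a) _ _ | tri≈ _ refl _ = cong (cyc⁻¹ (suc a)) (cyc-top a)
cyc⁻¹-cyc m (suc zero) (s≤s m≥1) _ | tri> _ _ (s≤s m<1) = ⊥-elim (<-irrefl refl (≤-trans (s≤s m≥1) m<1))
cyc⁻¹-cyc m (suc (suc a)) _ _ | tri> _ _ gt = trans (cong (cyc⁻¹ m) (cyc-above m (suc a) gt)) (cyc⁻¹-above m a gt)

Letter : ℕ → ℕ → Set
Letter n a = 1 ≤ a × a ≤ n

cyc-letter : ∀ m n x → m ≤ n → Letter n x → Letter n (cyc m x)
cyc-letter m n (suc a) m≤n (_ , x≤n) with <-cmp (suc a) m
... | tri< lt _ _ rewrite cyc-below m a lt = s≤s z≤n , ≤-trans lt m≤n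
cyc-letter .(suc a) n (suc a) m≤n (_ , x≤n) | tri≈ _ refl _ rewrite cyc-top a = s≤s z≤n , ≤-trans (s≤s z≤n) x≤n
... | tri> _ _ gt rewrite cyc-above m a gt = s≤s z≤n , x≤n

cyc⁻¹-letter : ∀ m n x → 1 ≤ m → m ≤ n → Letter n x → Letter n (cyc⁻¹ m x)
cyc⁻¹-letter m n (suc zero) 1≤m m≤n _ = 1≤m , m≤n
cyc⁻¹-letter m n (suc (suc a)) _ _ (_ , x≤n) with suc (suc a) ≤? m
... | yes le rewrite cyc⁻¹-below m a le = s≤s z≤n , ≤-trans (n≤1+n _) x≤n
... | no nle rewrite cyc⁻¹-above m a (≰⇒> nle) = s≤s z≤n , x≤n

window : {A : Set} → ℕ → ℕ → List A → List A
window t P X = take P (drop t X)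

module _ {A : Set} where

  take-+ : ∀ i r (X : List A) → take (i + r) X ≡ take i X ++ window i r X
  take-+ zero r X = refl
  take-+ (suc i) zero [] = refl
  take-+ (suc i) (suc r) [] = refl
  take-+ (suc i) r (x ∷ X) = cong (x ∷_) (take-+ i r X)

  length-take-≤ : ∀ r (X : List A) → r ≤ length X → length (take r X) ≡ r
  length-take-≤ r X le = trans (length-take r X) (m≤n⇒m⊓n≡m le)

  room-after : ∀ t K (X : List A) → t + K ≤ length X → K ≤ length (drop t X)
  room-after t K X le =
    subst (K ≤_) (sym (length-drop t X)) (m+n≤o⇒m≤o∸n K (subst (_≤ length X) (+-comm t K) le))

  length-window : ∀ t K (X : List A) → t + K ≤ length X → length (window t K X) ≡ K
  length-window t K X le = length-take-≤ K (drop t X) (room-after t K X le)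

  take-++ˡ : ∀ k (xs ys : List A) → k ≤ length xs → take k (xs ++ ys) ≡ take k xs
  take-++ˡ zero xs ys _ = refl
  take-++ˡ (suc k) (x ∷ xs) ys (s≤s le) = cong (x ∷_) (take-++ˡ k xs ys le)

  take-++ʳ : ∀ k (xs ys : List A) → take (length xs + k) (xs ++ ys) ≡ xs ++ take k ys
  take-++ʳ k [] ys = refl
  take-++ʳ k (x ∷ xs) ys = cong (x ∷_) (take-++ʳ k xs ys)

  drop-++ˡ : ∀ k (xs ys : List A) → k ≤ length xs → drop k (xs ++ ys) ≡ drop k xs ++ ys
  drop-++ˡ zero xs ys _ = refl
  drop-++ˡ (suc k) (x ∷ xs) ys (s≤s le) = drop-++ˡ k xs ys le

  window-++ˡ : ∀ d P (c z : List A) → d + P ≤ length c → window d P (c ++ z) ≡ window d P c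
  window-++ˡ d P c z le = trans (cong (take P) (drop-++ˡ d c z (m+n≤o⇒m≤o d le)))
    (take-++ˡ P (drop d c) z (room-after d P c le))

  at-++ˡ : ∀ i (xs ys : List A) → i < length xs → at (xs ++ ys) i ≡ at xs i
  at-++ˡ zero (x ∷ xs) ys _ = refl
  at-++ˡ (suc i) (x ∷ xs) ys (s≤s le) = at-++ˡ i xs ys le

  at-++ʳ : ∀ i (xs ys : List A) → at (xs ++ ys) (length xs + i) ≡ at ys i
  at-++ʳ i [] ys = refl
  at-++ʳ i (x ∷ xs) ys = at-++ʳ i xs ys

  at-take : ∀ i K (X : List A) → i < K → at (take K X) i ≡ at X i
  at-take i (suc K) [] _ = refl
  at-take zero (suc K) (x ∷ X) _ = refl
  at-take (suc i) (suc K) (x ∷ X) (s≤s le) = at-take i K X le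

  at-drop : ∀ t i (X : List A) → at (drop t X) i ≡ at X (t + i)
  at-drop zero i X = refl
  at-drop (suc t) zero [] = refl
  at-drop (suc t) (suc i) [] = refl
  at-drop (suc t) i (x ∷ X) = at-drop t i X

  at-window : ∀ t P i (X : List A) → i < P → at (window t P X) i ≡ at X (t + i)
  at-window t P i X i<P = trans (at-take i P (drop t X) i<P) (at-drop t i X)

  take-suc-at : ∀ p (X : List A) → p < length X →
    Σ A λ c → at X p ≡ just c × take (suc p) X ≡ take p X ++ c ∷ []
  take-suc-at zero (x ∷ X) _ = x , refl , refl
  take-suc-at (suc p) (x ∷ X) (s≤s le) with take-suc-at p X le
  ... | c , at-p , take-p = c , at-p , cong (x ∷_) take-p

  window-step : ∀ t p (X : List A) → t + suc p < length X →
    Σ A λ b → Σ (List A) λ T → Σ A λ c →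
      window t (suc p) X ≡ b ∷ T × window (suc t) (suc p) X ≡ T ++ c ∷ [] ×
      at X t ≡ just b × at X (t + suc p) ≡ just c
  window-step zero p (x ∷ X) (s≤s le) with take-suc-at p X le
  ... | c , at-p , take-p = x , take p X , c , refl , take-p , refl , at-p
  window-step (suc t) p (x ∷ X) (s≤s le) = window-step t p X le

  window-circFactor : ∀ (u : List A) σ t P → σ ≤ length u → σ ≤ t → t + P ≤ σ + length u →
    CircFactor (window t P (u ++ u)) u
  window-circFactor u σ t P σ≤u σ≤t tP with m≤n⇒∃[o]m+o≡n σ≤t
  ... | d , refl = c , (u₁ , u₂ , sym (take++drop≡id σ u) , refl) , (take d c , drop P (drop d c) , c-split)
    where
    u₁ u₂ c : List A
    u₁ = take σ u
    u₂ = drop σ u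
    c = u₂ ++ u₁
    length-c : length c ≡ length u
    length-c = trans (length-++ u₂) (trans (+-comm (length u₂) (length u₁))
      (trans (sym (length-++ u₁)) (cong length (take++drop≡id σ u))))
    dP : d + P ≤ length c
    dP = subst (d + P ≤_) (sym length-c) (+-cancelˡ-≤ σ _ _ (subst (_≤ σ + length u) (+-assoc σ d P) tP))
    uu-from-c : drop (σ + d) (u ++ u) ≡ drop d (c ++ u₂)
    uu-from-c = trans (sym (drop-drop σ d (u ++ u)))
      (cong (drop d) (trans (drop-++ˡ σ u u σ≤u)
        (trans (cong (u₂ ++_) (sym (take++drop≡id σ u))) (sym (++-assoc u₂ u₁ u₂)))))
    c-split : c ≡ take d c ++ window (σ + d) P (u ++ u) ++ drop P (drop d c)
    c-split = trans (sym (take++drop≡id d c)) (cong (take d c ++_)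
      (trans (sym (take++drop≡id P (drop d c)))
        (cong (_++ drop P (drop d c)) (sym (trans (cong (take P) uu-from-c) (window-++ˡ d P c u₂ dP))))))

  conjugate-in-square : ∀ (u : List A) σ e → σ ≤ length u → e ≤ σ + length u → e ≤ length (u ++ u)
  conjugate-in-square u σ e σ≤u e≤ =
    ≤-trans e≤ (≤-trans (+-monoˡ-≤ (length u) σ≤u) (≤-reflexive (sym (length-++ u))))

  circFactor-offset : ∀ (w z : List A) → CircFactor w z →
    ∃[ σ ] ∃[ s ] (σ ≤ length z × σ ≤ s × s + length w ≤ σ + length z ×
      (∀ i → i < length w → at (z ++ z) (s + i) ≡ at w i))
  circFactor-offset w z (c , (l , r , z≡lr , c≡rl) , (x , y , c≡xwy)) =
    length l , length l + length x , subst (length l ≤_) lr≡z (m≤m+n (length l) (length r)) ,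
    m≤m+n (length l) (length x) , within , letters
    where
    lr≡z : length l + length r ≡ length z
    lr≡z = trans (sym (length-++ l)) (cong length (sym z≡lr))
    xwy≡rl : length x + (length w + length y) ≡ length r + length l
    xwy≡rl = trans (sym (trans (length-++ x) (cong (length x +_) (length-++ w))))
      (trans (cong length (sym c≡xwy)) (trans (cong length c≡rl) (length-++ r)))
    within : length l + length x + length w ≤ length l + length z
    within = subst (_≤ length l + length z) (sym (+-assoc (length l) (length x) (length w)))
      (+-monoʳ-≤ (length l) (subst (length x + length w ≤_) (trans xwy≡rl (trans (+-comm (length r) (length l)) lr≡z))
        (+-monoʳ-≤ (length x) (m≤m+n (length w) (length y)))))
    zz≡ : z ++ z ≡ l ++ ((x ++ (w ++ y)) ++ r)
    zz≡ = trans (cong (λ v → v ++ v) z≡lr) (trans (++-assoc l r (l ++ r))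
      (cong (l ++_) (trans (sym (++-assoc r l r)) (cong (_++ r) (trans (sym c≡rl) c≡xwy)))))
    letters : ∀ i → i < length w → at (z ++ z) (length l + length x + i) ≡ at w i
    letters i i<w = begin
        at (z ++ z) (length l + length x + i)
      ≡⟨ cong₂ at zz≡ (+-assoc (length l) (length x) i) ⟩
        at (l ++ ((x ++ (w ++ y)) ++ r)) (length l + (length x + i))
      ≡⟨ at-++ʳ (length x + i) l _ ⟩
        at ((x ++ (w ++ y)) ++ r) (length x + i)
      ≡⟨ at-++ˡ (length x + i) (x ++ (w ++ y)) r
           (subst (length x + i <_) (sym (length-++ x))
             (+-monoʳ-< (length x) (subst (i <_) (sym (length-++ w)) (≤-trans i<w (m≤m+n (length w) (length y)))))) ⟩
        at (x ++ (w ++ y)) (length x + i)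
      ≡⟨ at-++ʳ i x (w ++ y) ⟩
        at (w ++ y) i
      ≡⟨ at-++ˡ i w y i<w ⟩
        at w i ∎
      where open ≡-Reasoning

act-++ : ∀ n x y a → act n (x ++ y) a ≡ act n y (act n x a)
act-++ n [] y a = refl
act-++ n (b ∷ x) y a = act-++ n x y (φgen n b a)

search-finds : ∀ n w i c a → i ≤ a → a < i + c → act n w a ≡ 1 → act n w (search n w i c) ≡ 1
search-finds n w i zero a i≤a a<i+0 _ = ⊥-elim (<⇒≱ a<i+0 (subst (_≤ a) (sym (+-identityʳ i)) i≤a))
search-finds n w i (suc c) a i≤a a<i+c a↦1 with act n w i ≟ 1
... | yes i↦1 = i↦1
... | no i↛1 = search-finds n w (suc i) c a
  (≤∧≢⇒< i≤a (λ i≡a → i↛1 (subst (λ z → act n w z ≡ 1) (sym i≡a) a↦1))) (subst (a <_) (+-suc i c) a<i+c) a↦1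

search-cong : ∀ n w w' i c → (∀ a → i ≤ a → a < i + c → act n w a ≡ act n w' a) →
  search n w i c ≡ search n w' i c
search-cong n w w' i zero _ = refl
search-cong n w w' i (suc c) agree with act n w i ≟ 1 | act n w' i ≟ 1
... | yes _ | yes _ = refl
... | yes i↦1 | no i↛1 = ⊥-elim (i↛1 (trans (sym (agree i ≤-refl i<i+c)) i↦1))
  where i<i+c = subst (i <_) (sym (+-suc i c)) (s≤s (m≤m+n i c))
... | no i↛1 | yes i↦1 = ⊥-elim (i↛1 (trans (agree i ≤-refl i<i+c) i↦1))
  where i<i+c = subst (i <_) (sym (+-suc i c)) (s≤s (m≤m+n i c))
... | no _ | no _ = search-cong n w w' (suc i) c
  (λ a i<a a<i+c → agree a (≤-trans (n≤1+n i) i<a) (subst (a <_) (sym (+-suc i c)) a<i+c))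

γaux-length : ∀ n R (w : List B) → length (γaux n R w) ≡ length w
γaux-length n R [] = refl
γaux-length n R (b ∷ w) = cong suc (γaux-length n (b ∷ R) w)

γ-length : ∀ n (X : List B) → length (γ n X) ≡ length X
γ-length n = γaux-length n []

γaux-at : ∀ n R P (w : List B) j → R ≡ reverse P → j < length w →
  at (γaux n R w) j ≡ just (preimageOf1 n (P ++ take (suc j) w))
γaux-at n R P (b ∷ w) zero R≡P⁻ _ = cong (λ z → just (preimageOf1 n z))
  (trans (cong (λ z → reverse (b ∷ z)) R≡P⁻)
    (trans (unfold-reverse b (reverse P)) (cong (_++ b ∷ []) (reverse-involutive P))))
γaux-at n R P (b ∷ w) (suc j) R≡P⁻ (s≤s j<w) =
  trans (γaux-at n (b ∷ R) (P ++ b ∷ []) w j (trans (cong (b ∷_) R≡P⁻) (sym (reverse-++ P (b ∷ [])))) j<w)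
    (cong (λ z → just (preimageOf1 n z)) (++-assoc P (b ∷ []) (take (suc j) w)))

γ-at : ∀ n (X : List B) j → j < length X → at (γ n X) j ≡ just (preimageOf1 n (take (suc j) X))
γ-at n X j = γaux-at n [] [] X j refl

module _ (n' : ℕ) where

  private
    n : ℕ
    n = suc (suc n')

  φ⁻¹ : B → ℕ → ℕ
  φ⁻¹ zero = cyc⁻¹ (suc n')
  φ⁻¹ (suc _) = cyc⁻¹ n

  φ-φ⁻¹ : ∀ b x → 1 ≤ x → φgen n b (φ⁻¹ b x) ≡ x
  φ-φ⁻¹ zero x 1≤x = cyc-cyc⁻¹ (suc n') x (s≤s z≤n) 1≤x
  φ-φ⁻¹ (suc _) x 1≤x = cyc-cyc⁻¹ n x (s≤s z≤n) 1≤x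

  φ⁻¹-φ : ∀ b x → 1 ≤ x → φ⁻¹ b (φgen n b x) ≡ x
  φ⁻¹-φ zero x 1≤x = cyc⁻¹-cyc (suc n') x (s≤s z≤n) 1≤x
  φ⁻¹-φ (suc _) x 1≤x = cyc⁻¹-cyc n x (s≤s z≤n) 1≤x

  φ-letter : ∀ b x → Letter n x → Letter n (φgen n b x)
  φ-letter zero x = cyc-letter (suc n') n x (n≤1+n _)
  φ-letter (suc _) x = cyc-letter n n x ≤-refl

  φ⁻¹-letter : ∀ b x → Letter n x → Letter n (φ⁻¹ b x)
  φ⁻¹-letter zero x = cyc⁻¹-letter (suc n') n x (s≤s z≤n) (n≤1+n _)
  φ⁻¹-letter (suc _) x = cyc⁻¹-letter n n x (s≤s z≤n) ≤-refl

  act-letter : ∀ w x → Letter n x → Letter n (act n w x)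
  act-letter [] x x-letter = x-letter
  act-letter (b ∷ w) x x-letter = act-letter w _ (φ-letter b x x-letter)

  act-injective : ∀ w x y → Letter n x → Letter n y → act n w x ≡ act n w y → x ≡ y
  act-injective [] x y _ _ e = e
  act-injective (b ∷ w) x y x-letter y-letter e = begin
      x
    ≡⟨ sym (φ⁻¹-φ b x (proj₁ x-letter)) ⟩
      φ⁻¹ b (φgen n b x)
    ≡⟨ cong (φ⁻¹ b) (act-injective w _ _ (φ-letter b x x-letter) (φ-letter b y y-letter) e) ⟩
      φ⁻¹ b (φgen n b y)
    ≡⟨ φ⁻¹-φ b y (proj₁ y-letter) ⟩
      y ∎
    where open ≡-Reasoning

  act⁻¹ : List B → ℕ → ℕ
  act⁻¹ [] x = x
  act⁻¹ (b ∷ w) x = φ⁻¹ b (act⁻¹ w x)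

  act⁻¹-letter : ∀ w x → Letter n x → Letter n (act⁻¹ w x)
  act⁻¹-letter [] x x-letter = x-letter
  act⁻¹-letter (b ∷ w) x x-letter = φ⁻¹-letter b _ (act⁻¹-letter w x x-letter)

  act-act⁻¹ : ∀ w x → Letter n x → act n w (act⁻¹ w x) ≡ x
  act-act⁻¹ [] x _ = refl
  act-act⁻¹ (b ∷ w) x x-letter =
    trans (cong (act n w) (φ-φ⁻¹ b _ (proj₁ (act⁻¹-letter w x x-letter)))) (act-act⁻¹ w x x-letter)

  preimage-correct : ∀ w → act n w (preimageOf1 n w) ≡ 1
  preimage-correct w = search-finds n w 1 n (act⁻¹ w 1) (proj₁ pre-letter) (s≤s (proj₂ pre-letter))
    (act-act⁻¹ w 1 one-letter)
    where
    one-letter : Letter n 1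
    one-letter = s≤s z≤n , s≤s z≤n
    pre-letter : Letter n (act⁻¹ w 1)
    pre-letter = act⁻¹-letter w 1 one-letter

  preimage-cong : ∀ w w' → (∀ a → Letter n a → act n w a ≡ act n w' a) → preimageOf1 n w ≡ preimageOf1 n w'
  preimage-cong w w' agree = search-cong n w w' 1 n (λ a 1≤a a<1+n → agree a (1≤a , ≤-pred a<1+n))

  fixes-all : ∀ W → FixesUpTo n W (suc n') → IsIdentity n W
  fixes-all W fix a 1≤a a≤n with a ≤? suc n'
  ... | yes a≤n-1 = fix a 1≤a a≤n-1
  ... | no a≰n-1 = subst (λ x → act n W x ≡ x) (sym (≤-antisym a≤n (≰⇒> a≰n-1))) top-fixed
    where
    top-letter : Letter n n
    top-letter = s≤s z≤n , ≤-refl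
    y : ℕ
    y = act n W n
    y-letter : Letter n y
    y-letter = act-letter W n top-letter
    top-fixed : y ≡ n
    top-fixed with y ≤? suc n'
    ... | no y≰n-1 = ≤-antisym (proj₂ y-letter) (≰⇒> y≰n-1)
    ... | yes y≤n-1 = ⊥-elim (<-irrefl y≡n (s≤s y≤n-1))
      where
      y≡n : y ≡ n
      y≡n = act-injective W y n y-letter top-letter (fix y (proj₁ y-letter) y≤n-1)

  -- φ_n(0) fixes n while φ_n(1) sends n to 1: a generator is determined by
  -- its value at n.
  generator-at-top : ∀ b c → φgen n b n ≡ φgen n c n → b ≡ c
  generator-at-top zero zero _ = refl
  generator-at-top (suc zero) (suc zero) _ = refl
  generator-at-top zero (suc zero) e with trans (sym (cyc-above (suc n') (suc n') ≤-refl)) (trans e (cyc-top (suc n')))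
  ... | ()
  generator-at-top (suc zero) zero e with trans (sym (cyc-above (suc n') (suc n') ≤-refl)) (trans (sym e) (cyc-top (suc n')))
  ... | ()

  -- If φ_n(bT) and φ_n(Tc) are both the identity then c = b, since φ_n(b)
  -- and φ_n(c) are both inverse to φ_n(T).
  identity-conjugates : ∀ b T c → IsIdentity n (b ∷ T) → IsIdentity n (T ++ c ∷ []) → c ≡ b
  identity-conjugates b T c bT-id Tc-id = generator-at-top c b (begin
      φgen n c n
    ≡⟨ cong (φgen n c) (sym (bT-id n (s≤s z≤n) ≤-refl)) ⟩
      φgen n c (act n T y)
    ≡⟨ sym (act-++ n T (c ∷ []) y) ⟩
      act n (T ++ c ∷ []) y
    ≡⟨ Tc-id y (proj₁ y-letter) (proj₂ y-letter) ⟩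
      y ∎)
    where
    open ≡-Reasoning
    y : ℕ
    y = φgen n b n
    y-letter : Letter n y
    y-letter = φ-letter b n (s≤s z≤n , ≤-refl)

  -- Below n-1 both generators act as r ↦ r+1, so a word z moves r to r+|z|
  -- as long as r+|z| ≤ n-1.
  φ-climbs : ∀ b r → 1 ≤ r → r < suc n' → φgen n b r ≡ suc r
  φ-climbs zero (suc a) _ lt = cyc-below (suc n') a lt
  φ-climbs (suc _) (suc a) _ lt = cyc-below n a (≤-trans lt (n≤1+n _))

  act-climbs : ∀ z r → 1 ≤ r → r + length z ≤ suc n' → act n z r ≡ r + length z
  act-climbs [] r _ _ = sym (+-identityʳ r)
  act-climbs (b ∷ z) r 1≤r le = begin
      act n z (φgen n b r)
    ≡⟨ cong (act n z) (φ-climbs b r 1≤r (≤-trans (s≤s (m≤m+n r (length z))) le')) ⟩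
      act n z (suc r)
    ≡⟨ act-climbs z (suc r) (s≤s z≤n) le' ⟩
      suc r + length z
    ≡⟨ sym (+-suc r (length z)) ⟩
      r + suc (length z) ∎
    where
    open ≡-Reasoning
    le' : suc r + length z ≤ suc n'
    le' = subst (_≤ suc n') (+-suc r (length z)) le

  -- The trace τ_X(i): the letter sent to 1 by the prefix X[0, i).  By γ-at,
  -- γ_n(X) = τ_X(1) ⋯ τ_X(|X|).
  trace : List B → ℕ → ℕ
  trace X i = preimageOf1 n (take i X)

  trace-climbs : ∀ X i r → i + r ≤ length X → suc r ≤ suc n' →
    act n (take (i + r) X) (trace X i) ≡ suc r
  trace-climbs X i r i+r≤X r<n-1 = begin
      act n (take (i + r) X) (trace X i)
    ≡⟨ cong (λ z → act n z (trace X i)) (take-+ i r X) ⟩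
      act n (take i X ++ window i r X) (trace X i)
    ≡⟨ act-++ n (take i X) _ (trace X i) ⟩
      act n (window i r X) (act n (take i X) (trace X i))
    ≡⟨ cong (act n (window i r X)) (preimage-correct (take i X)) ⟩
      act n (window i r X) 1
    ≡⟨ act-climbs (window i r X) 1 (s≤s z≤n) (subst (λ z → suc z ≤ suc n') (sym |window|) r<n-1) ⟩
      suc (length (window i r X))
    ≡⟨ cong suc |window| ⟩
      suc r ∎
    where
    open ≡-Reasoning
    |window| : length (window i r X) ≡ r
    |window| = length-window i r X i+r≤X

  -- A repetition τ_X(j) = τ_X(j+P) makes the window X[j+r, j+r+P) fix r+1:
  -- X[0, j+r) and X[0, j+P+r) both send the repeated letter to r+1.
  repeat-fixes : ∀ X j r P → trace X j ≡ trace X (j + P) → j + P + r ≤ length X → suc r ≤ suc n' →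
    act n (window (j + r) P X) (suc r) ≡ suc r
  repeat-fixes X j r P repeat j+P+r≤X r<n-1 = begin
      act n W (suc r)
    ≡⟨ cong (act n W) (sym (trace-climbs X j r j+r≤X r<n-1)) ⟩
      act n W (act n (take (j + r) X) (trace X j))
    ≡⟨ sym (act-++ n (take (j + r) X) W (trace X j)) ⟩
      act n (take (j + r) X ++ W) (trace X j)
    ≡⟨ cong₂ (act n) (trans (sym (take-+ (j + r) P X)) (cong (λ z → take z X) reorder)) repeat ⟩
      act n (take (j + P + r) X) (trace X (j + P))
    ≡⟨ trace-climbs X (j + P) r j+P+r≤X r<n-1 ⟩
      suc r ∎
    where
    open ≡-Reasoning
    W : List B
    W = window (j + r) P X
    reorder : j + r + P ≡ j + P + r
    reorder = solve 3 (λ j r P → j :+ r :+ P := j :+ P :+ r) refl j r P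
    j+r≤X : j + r ≤ length X
    j+r≤X = ≤-trans (+-monoˡ-≤ r (m≤m+n j P)) j+P+r≤X

  TracePeriodic : List B → ℕ → ℕ → ℕ → Set
  TracePeriodic X s m p = ∀ j → s < j → j + p ≤ s + m → trace X j ≡ trace X (j + p)

  periodic-window-fixes : ∀ X s m p t k → TracePeriodic X s m p → s + m ≤ length X →
    s + k ≤ t → t + p ≤ s + m → k ≤ suc n' → FixesUpTo n (window t p X) k
  periodic-window-fixes X s m p t k periodic s+m≤X s+k≤t t+p≤s+m k≤n-1 (suc r) _ r<k
    with m≤n⇒∃[o]m+o≡n (≤-trans (m≤n+m r s) (≤-trans (n≤1+n _) (subst (_≤ t) (+-suc s r) (≤-trans (+-monoʳ-≤ s r<k) s+k≤t))))
  ... | j , refl = subst (λ z → act n (window z p X) (suc r) ≡ suc r) (+-comm j r)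
        (repeat-fixes X j r p (periodic j s<j j+p≤s+m) j+p+r≤X (≤-trans r<k k≤n-1))
    where
    s<j : s < j
    s<j = +-cancelʳ-≤ r (suc s) j
      (subst₂ _≤_ (+-suc s r) (+-comm r j) (≤-trans (+-monoʳ-≤ s r<k) s+k≤t))
    j+p≤s+m : j + p ≤ s + m
    j+p≤s+m = ≤-trans (+-monoˡ-≤ p (m≤n+m j r)) t+p≤s+m
    j+p+r≤X : j + p + r ≤ length X
    j+p+r≤X = subst (_≤ length X) (solve 3 (λ j p r → r :+ j :+ p := j :+ p :+ r) refl j p r)
      (≤-trans t+p≤s+m s+m≤X)

  identity-windows-letter : ∀ X t p → 1 ≤ p → t + p < length X →
    IsIdentity n (window t p X) → IsIdentity n (window (suc t) p X) → at X (t + p) ≡ at X t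
  identity-windows-letter X t (suc p) _ lt id₀ id₁ with window-step t p X lt
  ... | b , T , c , w₀ , w₁ , at-t , at-t+p = begin
      at X (t + suc p)
    ≡⟨ at-t+p ⟩
      just c
    ≡⟨ cong just (identity-conjugates b T c (subst (IsIdentity n) w₀ id₀) (subst (IsIdentity n) w₁ id₁)) ⟩
      just b
    ≡⟨ sym at-t ⟩
      at X t ∎
    where open ≡-Reasoning

  sliding-identity-period : ∀ X t p e → 1 ≤ p → t + (p + e) ≤ length X →
    (∀ i → i ≤ e → IsIdentity n (window (t + i) p X)) → IsPeriod (window t (p + e) X) p
  sliding-identity-period X t p e 1≤p bnd identities = 1≤p , period
    where
    v : List B
    v = window t (p + e) X
    period : ∀ i → i + p < length v → at v (i + p) ≡ at v i
    period i i+p<v = begin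
        at v (i + p)
      ≡⟨ at-window t (p + e) (i + p) X i+p<p+e ⟩
        at X (t + (i + p))
      ≡⟨ cong (at X) (sym (+-assoc t i p)) ⟩
        at X (t + i + p)
      ≡⟨ identity-windows-letter X (t + i) p 1≤p inside (identities i (<⇒≤ i<e))
           (subst (λ z → IsIdentity n (window z p X)) (+-suc t i) (identities (suc i) i<e)) ⟩
        at X (t + i)
      ≡⟨ sym (at-window t (p + e) i X (≤-trans (s≤s (m≤m+n i p)) i+p<p+e)) ⟩
        at v i ∎
      where
      open ≡-Reasoning
      i+p<p+e : i + p < p + e
      i+p<p+e = subst (i + p <_) (length-window t (p + e) X bnd) i+p<v
      i<e : i < e
      i<e = +-cancelʳ-< p i e (subst (i + p <_) (+-comm p e) i+p<p+e)
      inside : t + i + p < length X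
      inside = subst (_< length X) (sym (+-assoc t i p)) (<-≤-trans (+-monoʳ-< t i+p<p+e) bnd)

  -- If φ_n(u) = id, the prefix u is invisible to later traces, so
  -- γ_n(u)γ_n(u) is the trace of uu.
  γ-square : ∀ u → IsIdentity n u → ∀ k → k < length u + length u →
    at (γ n u ++ γ n u) k ≡ just (trace (u ++ u) (suc k))
  γ-square u id-u k k<2|u| with k <? length u
  ... | yes k<|u| = begin
      at (γ n u ++ γ n u) k
    ≡⟨ at-++ˡ k (γ n u) (γ n u) (subst (k <_) (sym (γ-length n u)) k<|u|) ⟩
      at (γ n u) k
    ≡⟨ γ-at n u k k<|u| ⟩
      just (trace u (suc k))
    ≡⟨ cong (λ z → just (preimageOf1 n z)) (sym (take-++ˡ (suc k) u u k<|u|)) ⟩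
      just (trace (u ++ u) (suc k)) ∎
    where open ≡-Reasoning
  ... | no k≮|u| with m≤n⇒∃[o]m+o≡n (≮⇒≥ k≮|u|)
  ...   | k' , refl = begin
      at (γ n u ++ γ n u) (length u + k')
    ≡⟨ cong (λ z → at (γ n u ++ γ n u) (z + k')) (sym (γ-length n u)) ⟩
      at (γ n u ++ γ n u) (length (γ n u) + k')
    ≡⟨ at-++ʳ k' (γ n u) (γ n u) ⟩
      at (γ n u) k'
    ≡⟨ γ-at n u k' (+-cancelˡ-< (length u) k' (length u) k<2|u|) ⟩
      just (preimageOf1 n (take (suc k') u))
    ≡⟨ cong just (sym (u-invisible (take (suc k') u))) ⟩
      just (preimageOf1 n (u ++ take (suc k') u))
    ≡⟨ cong (λ z → just (preimageOf1 n z)) (sym (take-++ʳ (suc k') u u)) ⟩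
      just (trace (u ++ u) (length u + suc k'))
    ≡⟨ cong (λ z → just (trace (u ++ u) z)) (+-suc (length u) k') ⟩
      just (trace (u ++ u) (suc (length u + k'))) ∎
    where
    open ≡-Reasoning
    u-invisible : ∀ y → preimageOf1 n (u ++ y) ≡ preimageOf1 n y
    u-invisible y = preimage-cong (u ++ y) y
      (λ a (1≤a , a≤n) → trans (act-++ n u y a) (cong (act n y) (id-u a 1≤a a≤n)))

  trace-periodic : ∀ u w p → IsIdentity n u → CircFactor w (γ n u) → IsPeriod w p →
    ∃[ σ ] ∃[ s ] (σ ≤ length u × σ ≤ s × s + length w ≤ σ + length u ×
      TracePeriodic (u ++ u) s (length w) p)
  trace-periodic u w p id-u w-circ (_ , w-period) with circFactor-offset w (γ n u) w-circ
  ... | σ , s , σ≤γu , σ≤s , within , w-at =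
    σ , s , σ≤u , σ≤s , subst (λ z → s + length w ≤ σ + z) (γ-length n u) within , periodic
    where
    σ≤u : σ ≤ length u
    σ≤u = subst (σ ≤_) (γ-length n u) σ≤γu
    γu : List ℕ
    γu = γ n u
    X : List B
    X = u ++ u
    periodic : TracePeriodic X s (length w) p
    periodic j s<j j+p≤s+w with m≤n⇒∃[o]m+o≡n s<j
    ... | i , refl = just-injective (begin
          just (trace X (suc (s + i)))
        ≡⟨ sym (γ-square u id-u (s + i) (in-square i i<w)) ⟩
          at (γu ++ γu) (s + i)
        ≡⟨ w-at i i<w ⟩
          at w i
        ≡⟨ sym (w-period i i+p<w) ⟩
          at w (i + p)
        ≡⟨ sym (w-at (i + p) i+p<w) ⟩
          at (γu ++ γu) (s + (i + p))
        ≡⟨ γ-square u id-u (s + (i + p)) (in-square (i + p) i+p<w) ⟩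
          just (trace X (suc (s + (i + p))))
        ≡⟨ cong (λ z → just (trace X (suc z))) (sym (+-assoc s i p)) ⟩
          just (trace X (suc (s + i) + p)) ∎)
      where
      open ≡-Reasoning
      i+p<w : i + p < length w
      i+p<w = +-cancelˡ-≤ s (suc (i + p)) (length w)
        (subst (_≤ s + length w) (trans (cong suc (+-assoc s i p)) (sym (+-suc s (i + p)))) j+p≤s+w)
      i<w : i < length w
      i<w = ≤-trans (s≤s (m≤m+n i p)) i+p<w
      in-square : ∀ k → k < length w → s + k < length u + length u
      in-square k k<w = ≤-trans (subst (_≤ s + length w) (+-suc s k) (+-monoʳ-≤ s k<w))
        (≤-trans within (+-mono-≤ σ≤u (≤-reflexive (γ-length n u))))

  Outcome : List B → Set
  Outcome v = (∃[ k ] (KStabilizing n k v × 0 < length v × length v < k * (n ∸ 1))) ⊎ KernelRepetition n v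

  period-below-length : ∀ p m → n * p < m * suc n' → p ≤ m
  period-below-length p m exponent with p ≤? m
  ... | yes p≤m = p≤m
  ... | no p≰m = ⊥-elim (<⇒≱ exponent (≤-trans (*-monoˡ-≤ (suc n') (<⇒≤ (≰⇒> p≰m)))
                   (≤-trans (≤-reflexive (*-comm p (suc n'))) (m≤n+m (suc n' * p) p))))

  overhang-bound : ∀ p L → n * p < (p + L) * suc n' → p < L * suc n'
  overhang-bound p L exponent = +-cancelˡ-< (p * suc n') p (L * suc n')
    (subst₂ _<_ (trans (cong (p +_) (*-comm (suc n') p)) (+-comm p (p * suc n'))) (*-distribʳ-+ (suc n') p L) exponent)

  product-bound-pos : ∀ L {p} → p < L * suc n' → 1 ≤ L
  product-bound-pos (suc _) _ = s≤s z≤n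

  short-window-end : ∀ s p L → s + L + p ≡ s + (p + L)
  short-window-end = solve 3 (λ s p L → s :+ L :+ p := s :+ (p :+ L)) refl

  long-window-end : ∀ s p d → s + suc n' + (p + suc d) ≡ s + (p + (n + d))
  long-window-end = solve 4 (λ n' s p d → s :+ (con 1 :+ n') :+ (p :+ (con 1 :+ d)) := s :+ (p :+ (con 2 :+ n' :+ d))) refl n'

  short-overhang : ∀ X s p L → 1 ≤ p → L ≤ suc n' → p < L * suc n' → s + (p + L) ≤ length X →
    TracePeriodic X s (p + L) p → Outcome (window (s + L) p X)
  short-overhang X s p L 1≤p L≤n-1 p<L[n-1] bnd periodic =
    inj₁ (L , (1≤L , L≤n-1 , 1≤|v| , fixes) , 1≤|v| , subst (_< L * suc n') (sym |v|) p<L[n-1])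
    where
    window-end : s + L + p ≡ s + (p + L)
    window-end = short-window-end s p L
    |v| : length (window (s + L) p X) ≡ p
    |v| = length-window (s + L) p X (≤-trans (≤-reflexive window-end) bnd)
    1≤|v| : 1 ≤ length (window (s + L) p X)
    1≤|v| = subst (1 ≤_) (sym |v|) 1≤p
    1≤L : 1 ≤ L
    1≤L = product-bound-pos L p<L[n-1]
    fixes : FixesUpTo n (window (s + L) p X) L
    fixes = periodic-window-fixes X s (p + L) p (s + L) L periodic bnd ≤-refl (≤-reflexive window-end) L≤n-1

  -- Overhang L = n+d ≥ n: every length-p window at offset ≥ n-1 fixes
  -- 1, …, n-1, hence is an identity; so the factor they cover, of length
  -- p+d+1, has period p and is a kernel repetition.
  long-overhang : ∀ X s p d → 1 ≤ p → n * p < (p + (n + d)) * suc n' → s + (p + (n + d)) ≤ length X →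
    TracePeriodic X s (p + (n + d)) p → KernelRepetition n (window (s + suc n') (p + suc d) X)
  long-overhang X s p d 1≤p exponent bnd periodic =
    p , sliding-identity-period X t p (suc d) 1≤p v-inside identities ,
    (take p v , ([] , drop p v , sym (take++drop≡id p v)) ,
      length-take-≤ p v (subst (p ≤_) (sym |v|) (m≤m+n p (suc d))) , first-identity) ,
    subst (n * p <_) (trans split (cong (λ z → z * suc n' + suc n' * suc n') (sym |v|))) exponent
    where
    t : ℕ
    t = s + suc n'
    v : List B
    v = window t (p + suc d) X
    v-inside : t + (p + suc d) ≤ length X
    v-inside = ≤-trans (≤-reflexive (long-window-end s p d)) bnd
    |v| : length v ≡ p + suc d
    |v| = length-window t (p + suc d) X v-inside
    identities : ∀ i → i ≤ suc d → IsIdentity n (window (t + i) p X)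
    identities i i≤d+1 = fixes-all (window (t + i) p X)
      (periodic-window-fixes X s _ p (t + i) (suc n') periodic bnd (m≤m+n t i) inside ≤-refl)
      where
      inside : t + i + p ≤ s + (p + (n + d))
      inside = ≤-trans (+-monoˡ-≤ p (+-monoʳ-≤ t i≤d+1))
        (≤-reflexive (trans (+-assoc t (suc d) p) (trans (cong (t +_) (+-comm (suc d) p)) (long-window-end s p d))))
    first-identity : IsIdentity n (take p v)
    first-identity = subst (IsIdentity n)
      (sym (trans (take-take p (p + suc d) (drop t X)) (cong (λ z → take z (drop t X)) (m≤n⇒m⊓n≡m (m≤m+n p (suc d))))))
      (subst (λ z → IsIdentity n (window z p X)) (+-identityʳ t) (identities 0 z≤n))
    split : (p + (n + d)) * suc n' ≡ (p + suc d) * suc n' + suc n' * suc n'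
    split = solve 3 (λ n' p d → (p :+ (con 2 :+ n' :+ d)) :* (con 1 :+ n')
                                := (p :+ (con 1 :+ d)) :* (con 1 :+ n') :+ (con 1 :+ n') :* (con 1 :+ n')) refl n' p d

  periodic-trace-outcome : ∀ u σ s m p → σ ≤ length u → σ ≤ s → s + m ≤ σ + length u → 1 ≤ p →
    n * p < m * suc n' → TracePeriodic (u ++ u) s m p → ∃[ v ] (CircFactor v u × Outcome v)
  periodic-trace-outcome u σ s m p σ≤u σ≤s within 1≤p exponent periodic
    with m≤n⇒∃[o]m+o≡n (period-below-length p m exponent)
  ... | L , refl with L ≤? suc n'
  ...   | yes L≤n-1 =
    window (s + L) p X ,
    window-circFactor u σ (s + L) p σ≤u (≤-trans σ≤s (m≤m+n s L)) (≤-trans (≤-reflexive (short-window-end s p L)) within) ,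
    short-overhang X s p L 1≤p L≤n-1 (overhang-bound p L exponent) (conjugate-in-square u σ _ σ≤u within) periodic
    where
    X : List B
    X = u ++ u
  ...   | no L≰n-1 with m≤n⇒∃[o]m+o≡n (≰⇒> L≰n-1)
  ...     | d , refl =
    window (s + suc n') (p + suc d) X ,
    window-circFactor u σ (s + suc n') (p + suc d) σ≤u (≤-trans σ≤s (m≤m+n s (suc n')))
      (≤-trans (≤-reflexive (long-window-end s p d)) within) ,
    inj₂ (long-overhang X s p d 1≤p exponent (conjugate-in-square u σ _ σ≤u within) periodic)
    where
    X : List B
    X = u ++ u

-- The theorem.
lemma7 : (n : ℕ) → 27 ≤ n → (u : List B) → IsIdentity n u →
    (∃[ w ] (CircFactor w (γ n u) × ExponentGreaterThan w n (n ∸ 1))) →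
    ∃[ v ] (CircFactor v u ×
    ((∃[ k ] (KStabilizing n k v × 0 < length v × length v < k * (n ∸ 1)))
    ⊎ KernelRepetition n v))
lemma7 zero () _ _ _
lemma7 (suc zero) (s≤s ()) _ _ _
lemma7 (suc (suc n')) _ u id-u (w , w-circ , p , w-period , exponent)
  with trace-periodic n' u w p id-u w-circ w-period
... | σ , s , σ≤u , σ≤s , within , periodic =
  periodic-trace-outcome n' u σ s (length w) p σ≤u σ≤s within (proj₁ w-period) exponent periodic
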